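{- Let $\Delta_1,\Delta_2,\Delta_3$ be integers and let $s_1,s_2,s_3,a_1,a_2,a_3$ be positive integers with $s_1<s_2<s_3$. Suppose that $\Delta_1s_1+\Delta_2s_2+\Delta_3s_3=0$; $\Delta_j\ge -a_j$ for $j=1,2,3$; $s_3>s_1a_1+s_2a_2$; $s_2>s_1a_1$; $\gcd(s_1,s_2)=1$; and $s_3\ge s_2^2/s_1$. Then $\Delta_1+\Delta_2+\Delta_3\ge 0$. -}

module Defs where

-- Suppose Δ₁ + Δ₂ + Δ₃ < 0; we show that Δ₁s₁ + Δ₂s₂ + Δ₃s₃ cannot vanish, by cases on Δ₃.
-- If Δ₃ ≥ 1, the term Δ₃s₃ ≥ s₃ outweighs the least possible value −(s₁a₁ + s₂a₂) of the
-- other two terms; likewise Δ₂s₂ outweighs −s₁a₁ if Δ₃ = 0 and Δ₂ ≥ 1. If Δ₃ = 0 and Δ₂ ≤ 0,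
-- then Δ₁s₁ + Δ₂s₂ ≤ (Δ₁ + Δ₂)s₁ < 0. If Δ₃ ≤ −1, the sum is at most a₁s₂ − a₁s₁ − s₃,
-- which is negative since s₁a₁s₂ < s₂² ≤ s₁s₃.
module Submission where

open import Defs
open import Data.Nat as ℕ using (ℕ)
open import Data.Nat.GCD using (gcd)
open import Data.Integer as ℤ using (ℤ; +_; -_; _+_; _*_; _≤_)
open import Relation.Binary.PropositionalEquality using (_≡_)

open import Data.Empty using (⊥-elim)
open import Data.Integer
  using (_<_; _-_; 0ℤ; 1ℤ; +0; +[1+_]; -[1+_]; +<+; +≤+; -<+; nonNegative; nonPositive; positive)
open import Data.Integer.Properties
open import Data.Integer.Tactic.RingSolver using (solve-∀)
import Data.Nat.Properties as ℕ
open import Relation.Binary.PropositionalEquality using (_≢_; ≢-sym; sym; trans; cong; subst)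
open import Relation.Nullary using (yes; no)

s*a<t⇒t*t≤s*u⇒a*t<u : ∀ s a {t u} → s ℕ.* a ℕ.< t → t ℕ.* t ℕ.≤ s ℕ.* u → a ℕ.* t ℕ.< u
s*a<t⇒t*t≤s*u⇒a*t<u s a {t} {u} sa<t tt≤su = ℕ.*-cancelˡ-< s (a ℕ.* t) u (begin-strict
  s ℕ.* (a ℕ.* t)  ≡⟨ ℕ.*-assoc s a t ⟨
  s ℕ.* a ℕ.* t    <⟨ ℕ.*-monoˡ-< t {{ℕ.>-nonZero (ℕ.≤-<-trans ℕ.z≤n sa<t)}} sa<t ⟩
  t ℕ.* t          ≤⟨ tt≤su ⟩
  s ℕ.* u          ∎)
  where open ℕ.≤-Reasoning

-a≤i⇒-[s*a]≤i*s : ∀ {a} i s → - + a ≤ i → - + (s ℕ.* a) ≤ i * + s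
-a≤i⇒-[s*a]≤i*s {a} i s -a≤i = begin
  - + (s ℕ.* a)  ≡⟨ cong -_ (trans (pos-* s a) (*-comm (+ s) (+ a))) ⟩
  - (+ a * + s)  ≡⟨ neg-distribˡ-* (+ a) (+ s) ⟩
  - + a * + s    ≤⟨ *-monoʳ-≤-nonNeg (+ s) -a≤i ⟩
  i * + s        ∎
  where open ≤-Reasoning

-a≤i⇒-b≤j⇒-[a+b]≤i+j : ∀ {a b i j} → - + a ≤ i → - + b ≤ j → - + (a ℕ.+ b) ≤ i + j
-a≤i⇒-b≤j⇒-[a+b]≤i+j {a} {b} {i} {j} -a≤i -b≤j = begin
  - + (a ℕ.+ b)    ≡⟨ cong -_ (pos-+ a b) ⟩
  - (+ a + + b)    ≡⟨ neg-distrib-+ (+ a) (+ b) ⟩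
  - + a + - + b    ≤⟨ +-mono-≤ -a≤i -b≤j ⟩
  i + j            ∎
  where open ≤-Reasoning

-b≤v⇒0<v+j*t : ∀ {b v} j t → - + b ≤ v → b ℕ.< t → 0ℤ < j → 0ℤ < v + j * + t
-b≤v⇒0<v+j*t {b} {v} j t -b≤v b<t 0<j = begin-strict
  0ℤ               ≡⟨ +-inverseˡ (+ b) ⟨
  - + b + + b      <⟨ +-monoʳ-< (- + b) (+<+ b<t) ⟩
  - + b + + t      ≡⟨ cong (_+_ (- + b)) (*-identityˡ (+ t)) ⟨
  - + b + 1ℤ * + t ≤⟨ +-mono-≤ -b≤v (*-monoʳ-≤-nonNeg (+ t) (i<j⇒suc[i]≤j 0<j)) ⟩
  v + j * + t      ∎
  where open ≤-Reasoning

i+j<0⇒i*s+j*t<0 : ∀ i j {s t} → i + j < 0ℤ → j ≤ 0ℤ → 0 ℕ.< s → s ℕ.≤ t → i * + s + j * + t < 0ℤ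
i+j<0⇒i*s+j*t<0 i j {s} {t} i+j<0 j≤0 0<s s≤t = begin-strict
  i * + s + j * + t  ≤⟨ +-monoʳ-≤ (i * + s) (*-monoˡ-≤-nonPos j {{nonPositive j≤0}} (+≤+ s≤t)) ⟩
  i * + s + j * + s  ≡⟨ *-distribʳ-+ (+ s) i j ⟨
  (i + j) * + s      <⟨ *-monoʳ-<-pos (+ s) {{positive (+<+ 0<s)}} i+j<0 ⟩
  0ℤ                 ∎
  where open ≤-Reasoning

i+j+k<0⇒i*s+j*t+k*u<0 : ∀ {a} i j k {s t u} → i + j + k < 0ℤ → - + a ≤ i → k < 0ℤ →
  s ℕ.≤ t → t ℕ.≤ u → a ℕ.* t ℕ.< u → i * + s + j * + t + k * + u < 0ℤ
i+j+k<0⇒i*s+j*t+k*u<0 {a} i j k {s} {t} {u} i+j+k<0 -a≤i k<0 s≤t t≤u at<u = begin-strict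
  i * S + j * T + k * U
    ≡⟨ regroup A i j k S T U ⟩
  (i + A) * S + j * T + (k + 1ℤ) * U - (A * S + U)
    -- i + a ≥ 0 and k + 1 ≤ 0: moving the weights s and u to t can only increase the sum
    ≤⟨ +-monoˡ-≤ (- (A * S + U)) (+-mono-≤ (+-monoˡ-≤ (j * T) [i+a]s≤[i+a]t) [k+1]u≤[k+1]t) ⟩
  (i + A) * T + j * T + (k + 1ℤ) * T - (A * S + U)
    ≡⟨ collect A i j k T (A * S + U) ⟩
  (i + j + k + 1ℤ) * T + A * T - (A * S + U)
    ≤⟨ +-monoˡ-≤ (- (A * S + U)) (+-monoˡ-≤ (A * T) (*-monoʳ-≤-nonNeg T (x<0⇒x+1≤0 i+j+k<0))) ⟩
  0ℤ * T + A * T - (A * S + U)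
    <⟨ +-monoʳ-< (0ℤ * T + A * T) (neg-mono-< at<as+u) ⟩
  0ℤ * T + A * T - A * T
    ≡⟨ cancel T (A * T) ⟩
  0ℤ ∎
  where
  open ≤-Reasoning
  A = + a
  S = + s
  T = + t
  U = + u
  regroup : ∀ a i j k s t u → i * s + j * t + k * u ≡ (i + a) * s + j * t + (k + 1ℤ) * u - (a * s + u)
  regroup = solve-∀
  collect : ∀ a i j k t c → (i + a) * t + j * t + (k + 1ℤ) * t - c ≡ (i + j + k + 1ℤ) * t + a * t - c
  collect = solve-∀
  cancel : ∀ t x → 0ℤ * t + x - x ≡ 0ℤ
  cancel = solve-∀
  x<0⇒x+1≤0 : ∀ {x} → x < 0ℤ → x + 1ℤ ≤ 0ℤ
  x<0⇒x+1≤0 {x} x<0 = ≤-trans (≤-reflexive (+-comm x 1ℤ)) (i<j⇒suc[i]≤j x<0)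
  0≤i+a : 0ℤ ≤ i + A
  0≤i+a = ≤-trans (≤-reflexive (sym (+-inverseˡ A))) (+-monoˡ-≤ A -a≤i)
  [i+a]s≤[i+a]t : (i + A) * S ≤ (i + A) * T
  [i+a]s≤[i+a]t = *-monoˡ-≤-nonNeg (i + A) {{nonNegative 0≤i+a}} (+≤+ s≤t)
  [k+1]u≤[k+1]t : (k + 1ℤ) * U ≤ (k + 1ℤ) * T
  [k+1]u≤[k+1]t = *-monoˡ-≤-nonPos (k + 1ℤ) {{nonPositive (x<0⇒x+1≤0 k<0)}} (+≤+ t≤u)
  at<as+u : A * T < A * S + U
  at<as+u = begin-strict
    A * T              ≡⟨ pos-* a t ⟨
    + (a ℕ.* t)        <⟨ +<+ (ℕ.<-≤-trans at<u (ℕ.m≤n+m u (a ℕ.* s))) ⟩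
    + (a ℕ.* s ℕ.+ u)  ≡⟨ trans (pos-+ (a ℕ.* s) u) (cong (_+ U) (pos-* a s)) ⟩
    A * S + U          ∎

proposition1 : (Δ₁ Δ₂ Δ₃ : ℤ) (s₁ s₂ s₃ a₁ a₂ a₃ : ℕ) →
    0 ℕ.< s₁ → 0 ℕ.< s₂ → 0 ℕ.< s₃ → 0 ℕ.< a₁ → 0 ℕ.< a₂ → 0 ℕ.< a₃ →
    s₁ ℕ.< s₂ → s₂ ℕ.< s₃ →
    Δ₁ * + s₁ + Δ₂ * + s₂ + Δ₃ * + s₃ ≡ + 0 →
    - + a₁ ≤ Δ₁ → - + a₂ ≤ Δ₂ → - + a₃ ≤ Δ₃ →
    s₁ ℕ.* a₁ ℕ.+ s₂ ℕ.* a₂ ℕ.< s₃ →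
    s₁ ℕ.* a₁ ℕ.< s₂ →
    gcd s₁ s₂ ≡ 1 →
    s₂ ℕ.* s₂ ℕ.≤ s₁ ℕ.* s₃ →
    + 0 ≤ Δ₁ + Δ₂ + Δ₃
proposition1 Δ₁ Δ₂ Δ₃ s₁ s₂ s₃ a₁ a₂ _ 0<s₁ _ _ _ _ _ s₁<s₂ s₂<s₃ Σ≡0 -a₁≤Δ₁ -a₂≤Δ₂ _
             s₁a₁+s₂a₂<s₃ s₁a₁<s₂ _ s₂s₂≤s₁s₃ with 0ℤ ≤? Δ₁ + Δ₂ + Δ₃
... | yes 0≤Δ = 0≤Δ
... | no 0≰Δ = ⊥-elim (Σ≢0 Δ₃ (≰⇒> 0≰Δ) Σ≡0)
  where
  -[s₁a₁+s₂a₂]≤Δ₁s₁+Δ₂s₂ : - + (s₁ ℕ.* a₁ ℕ.+ s₂ ℕ.* a₂) ≤ Δ₁ * + s₁ + Δ₂ * + s₂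
  -[s₁a₁+s₂a₂]≤Δ₁s₁+Δ₂s₂ =
    -a≤i⇒-b≤j⇒-[a+b]≤i+j (-a≤i⇒-[s*a]≤i*s Δ₁ s₁ -a₁≤Δ₁) (-a≤i⇒-[s*a]≤i*s Δ₂ s₂ -a₂≤Δ₂)
  Δ₁s₁+Δ₂s₂≢0 : Δ₁ + Δ₂ < 0ℤ → Δ₁ * + s₁ + Δ₂ * + s₂ ≢ 0ℤ
  Δ₁s₁+Δ₂s₂≢0 Δ<0 with Δ₂ ≤? 0ℤ
  ... | yes Δ₂≤0 = <⇒≢ (i+j<0⇒i*s+j*t<0 Δ₁ Δ₂ Δ<0 Δ₂≤0 0<s₁ (ℕ.<⇒≤ s₁<s₂))
  ... | no Δ₂≰0 =
    ≢-sym (<⇒≢ (-b≤v⇒0<v+j*t Δ₂ s₂ (-a≤i⇒-[s*a]≤i*s Δ₁ s₁ -a₁≤Δ₁) s₁a₁<s₂ (≰⇒> Δ₂≰0)))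
  Σ≢0 : ∀ δ → Δ₁ + Δ₂ + δ < 0ℤ → Δ₁ * + s₁ + Δ₂ * + s₂ + δ * + s₃ ≢ 0ℤ
  Σ≢0 +[1+ n ] _ =
    ≢-sym (<⇒≢ (-b≤v⇒0<v+j*t +[1+ n ] s₃ -[s₁a₁+s₂a₂]≤Δ₁s₁+Δ₂s₂ s₁a₁+s₂a₂<s₃ (+<+ ℕ.z<s)))
  Σ≢0 +0 Δ<0 Σ≡0 =
    Δ₁s₁+Δ₂s₂≢0 (subst (_< 0ℤ) (+-identityʳ (Δ₁ + Δ₂)) Δ<0) (trans (sym (+-identityʳ _)) Σ≡0)
  Σ≢0 -[1+ n ] Δ<0 =
    <⇒≢ (i+j+k<0⇒i*s+j*t+k*u<0 Δ₁ Δ₂ -[1+ n ] Δ<0 -a₁≤Δ₁ -<+ (ℕ.<⇒≤ s₁<s₂) (ℕ.<⇒≤ s₂<s₃)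
           (s*a<t⇒t*t≤s*u⇒a*t<u s₁ a₁ s₁a₁<s₂ s₂s₂≤s₁s₃))
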